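{- Let $f,g,h:\{0,1\}^n\to\{0,1\}$ be Boolean functions with $f=g.h$, and let $P\in\mathcal{P}_{g,h}$ be arbitrary. Then: (1) If $g$ and $\zeta[h,g,P]$ are (each) satisfiable, then $f$ is satisfiable. (2) The solution set of $\zeta[h,g,P](x)=1$ equals the solution set of $f(x)=1$. (3) If one of $g$, $\zeta[h,g,P]$ is identically $0$, then $f$ is identically $0$.
   Context: Boolean functions are maps $\{0,1\}^n\to\{0,1\}$; $g.h$ is pointwise AND; a Boolean function is satisfiable if it takes the value $1$ at some point. $g_{ON}=\{x:g(x)=1\}$, $g_{OFF}=\{x:g(x)=0\}$. $\mathcal{P}_{g,h}$ is the set of all maps $P:\{0,1\}^n\to\{0,1\}^n$ with $P(x)=x$ for $x\in g_{ON}$ and $P(x)\in h_{OFF}$ for $x\in g_{OFF}$. $\zeta[h,g,P]$ denotes the Boolean function $x\mapsto h(P(x))$. -}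

module Defs where

open import Data.Bool using (Bool; true; false; _∧_)
open import Data.Nat using (ℕ)
open import Data.Vec using (Vec)
open import Data.Product using (Σ; _×_)
open import Relation.Binary.PropositionalEquality using (_≡_)

Bits : ℕ → Set
Bits n = Vec Bool n

BoolFn : ℕ → Set
BoolFn n = Bits n → Bool

_·_ : ∀ {n} → BoolFn n → BoolFn n → BoolFn n
(g · h) x = g x ∧ h x

Satisfiable : ∀ {n} → BoolFn n → Set
Satisfiable {n} g = Σ (Bits n) (λ x → g x ≡ true)

IdenticallyZero : ∀ {n} → BoolFn n → Set
IdenticallyZero {n} g = (x : Bits n) → g x ≡ false

InP : ∀ {n} → BoolFn n → BoolFn n → (Bits n → Bits n) → Set
InP {n} g h P =
  ((x : Bits n) → g x ≡ true → P x ≡ x) ×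
  ((x : Bits n) → g x ≡ false → h (P x) ≡ false)

ζ : ∀ {n} → BoolFn n → BoolFn n → (Bits n → Bits n) → BoolFn n
ζ h g P x = h (P x)

module Submission where

open import Defs
open import Data.Bool using (true; false)
open import Data.Nat using (ℕ)
open import Data.Product using (_×_; _,_)
open import Data.Sum using (_⊎_; inj₁; inj₂)
open import Relation.Binary.PropositionalEquality using (_≡_; refl; sym; trans; cong; _≗_)

-- Whatever P does, h ∘ P agrees with g · h: on g_ON P is the identity, and
-- on g_OFF both sides are 0.  So ζ[h,g,P] is just f in disguise.
ζ≗· : ∀ {n} {g h : BoolFn n} {P : Bits n → Bits n} → InP g h P → ζ h g P ≗ g · h
ζ≗· {g = g} {h} {P} (fix-on , kill-off) x with g x in gx
... | true  = cong h (fix-on x gx)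
... | false = kill-off x gx

satisfiable-resp-≗ : ∀ {n} {f g : BoolFn n} → f ≗ g → Satisfiable f → Satisfiable g
satisfiable-resp-≗ f≗g (x , fx) = x , trans (sym (f≗g x)) fx

identicallyZero-resp-≗ : ∀ {n} {f g : BoolFn n} → f ≗ g → IdenticallyZero f → IdenticallyZero g
identicallyZero-resp-≗ f≗g zero x = trans (sym (f≗g x)) (zero x)

·-identicallyZeroˡ : ∀ {n} {g : BoolFn n} (h : BoolFn n) → IdenticallyZero g → IdenticallyZero (g · h)
·-identicallyZeroˡ {g = g} h zero x rewrite zero x = refl

corollary1 : (n : ℕ) (f g h : BoolFn n) → ((x : Bits n) → f x ≡ (g · h) x) →
    (P : Bits n → Bits n) → InP g h P →
    ((Satisfiable g × Satisfiable (ζ h g P) → Satisfiable f)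
    × ((x : Bits n) → (ζ h g P x ≡ true → f x ≡ true) × (f x ≡ true → ζ h g P x ≡ true))
    × (IdenticallyZero g ⊎ IdenticallyZero (ζ h g P) → IdenticallyZero f))
corollary1 n f g h f≗g·h P P∈𝒫 =
    (λ (_ , satζ) → satisfiable-resp-≗ ζ≗f satζ)
  , (λ x → trans (sym (ζ≗f x)) , trans (ζ≗f x))
  , λ { (inj₁ g≡0) → identicallyZero-resp-≗ (λ x → sym (f≗g·h x)) (·-identicallyZeroˡ h g≡0)
      ; (inj₂ ζ≡0) → identicallyZero-resp-≗ ζ≗f ζ≡0 }
  where
  ζ≗f : ζ h g P ≗ f
  ζ≗f x = trans (ζ≗· P∈𝒫 x) (sym (f≗g·h x))
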